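{- Let $\mathcal{K}$ be the set of all positions of misère partizan Kayles. If $G\in\mathcal{K}$, then $G\geqq G^L+S_1 \pmod{\mathcal{K}}$ for every Left option $G^L$ of $G$.
   Context: Partizan Kayles is played on $1\times n$ strips of squares; $S_n$ denotes an empty strip of length $n$ ($S_0=0$). Left moves by placing a single square on one empty cell; Right moves by placing a domino covering two adjacent empty cells of the same strip; a placement splits a strip into the strips of empty cells on either side. A position is a disjunctive sum of strips, and $\mathcal{K}$ is the set of all such sums (closed under disjunctive sum and followers). A Left option $G^L$ of $G$ is a position reachable by one Left move. Under misère play a player unable to move on their turn wins. Outcomes are $\mathcal{L}$ (Left wins moving first or second), $\mathcal{R}$ (Right wins moving first or second), $\mathcal{N}$ (first player wins), $\mathcal{P}$ (second player wins), partially ordered by $\mathcal{L}>\mathcal{N}>\mathcal{R}$, $\mathcal{L}>\mathcal{P}>\mathcal{R}$, with $\mathcal{N},\mathcal{P}$ incomparable; $o^-(G)$ denotes the misère outcome. For games $G,H$, $G\geqq H\pmod{\mathcal{K}}$ means $o^-(G+X)\ge o^-(H+X)$ for every $X\in\mathcal{K}$. -}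

module Defs where

open import Data.Nat using (ℕ; zero; suc; _+_; _∸_)
open import Data.Bool using (Bool; true; false; _∧_; _∨_; not)
open import Data.List using (List; []; _∷_; _++_; map; upTo; null)
open import Data.Nat.ListAction using (sum)
open import Data.Bool.ListAction using (any; all)
open import Data.Product using (_×_; _,_)

-- A position of partizan Kayles: a disjunctive sum of strips, given as the
-- list of strip lengths (S_n is the one-element list [n]; S_0 has no moves).
Pos : Set
Pos = List ℕ

S : ℕ → Pos
S n = n ∷ []

_⊕_ : Pos → Pos → Pos
G ⊕ H = G ++ H
infixl 6 _⊕_

-- Left places a square on cell j (0 ≤ j < n): leaves strips j and n-1-j.
splitsL : ℕ → List (ℕ × ℕ)
splitsL n = map (λ j → j , (n ∸ 1) ∸ j) (upTo n)

-- Right places a domino on cells j, j+1 (j + 2 ≤ n): leaves strips j and n-2-j.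
splitsR : ℕ → List (ℕ × ℕ)
splitsR n = map (λ j → j , (n ∸ 2) ∸ j) (upTo (n ∸ 1))

options : (ℕ → List (ℕ × ℕ)) → Pos → List Pos
options sp [] = []
options sp (x ∷ rest) =
  map (λ { (a , b) → a ∷ b ∷ rest }) (sp x) ++ map (x ∷_) (options sp rest)

leftOptions : Pos → List Pos
leftOptions = options splitsL

rightOptions : Pos → List Pos
rightOptions = options splitsR

-- Misère play, with fuel (each move decreases the number of empty cells,
-- so fuel = 1 + number of empty cells is enough).
-- leftWinsFirst  : Left moving first wins;  leftWinsSecond : Right moving first, Left wins.
mutual
  leftWinsFirst : ℕ → Pos → Bool
  leftWinsFirst zero G = false
  leftWinsFirst (suc k) G =
    null (leftOptions G) ∨ any (leftWinsSecond k) (leftOptions G)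

  leftWinsSecond : ℕ → Pos → Bool
  leftWinsSecond zero G = false
  leftWinsSecond (suc k) G =
    not (null (rightOptions G)) ∧ all (leftWinsFirst k) (rightOptions G)

data Outcome : Set where
  𝓛 𝓝 𝓟 𝓡 : Outcome

outcomeOf : Bool → Bool → Outcome
outcomeOf true  true  = 𝓛
outcomeOf true  false = 𝓝
outcomeOf false true  = 𝓟
outcomeOf false false = 𝓡

o⁻ : Pos → Outcome
o⁻ G = outcomeOf (leftWinsFirst (suc (sum G)) G) (leftWinsSecond (suc (sum G)) G)

data _≥ₒ_ : Outcome → Outcome → Set where
  refl≥ : ∀ {o} → o ≥ₒ o
  L≥    : ∀ {o} → 𝓛 ≥ₒ o
  ≥R    : ∀ {o} → o ≥ₒ 𝓡

_≧K_ : Pos → Pos → Set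
G ≧K H = (X : Pos) → o⁻ (G ⊕ X) ≥ₒ o⁻ (H ⊕ X)

-- Give a strip of length n the weight 0, −1 or 1 according as n ≡ 0, 1 or 2
-- (mod 3), and a position the sum of the weights of its strips, its potential.
-- A Left move raises the potential by 1 or lowers it by 2, a Right move does the
-- opposite; moreover Left can raise the potential unless every strip has length
-- 0 or 2, and Right, whenever it can move at all, can lower it by 1.  By
-- induction on the game, Left wins moving first exactly when the potential is a
-- nonnegative multiple of 3, and moving second exactly when it is one more than
-- such a multiple, so the misère outcome is a function of the potential.
-- Replacing G by G^L + S₁ changes the potential by 0 or by −3, and lowering the
-- potential by 3 can only make the outcome worse for Left.
module Submission where

open import Defs

open import Data.Bool using (Bool; true; false; T; _∧_; _∨_; not)
open import Data.Bool.Properties using (T-≡; ⇔→≡)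
open import Data.Bool.ListAction using (any; all; and; or)
open import Data.Empty using (⊥-elim)
open import Data.Integer using (ℤ; +_; -[1+_]; _+_; 0ℤ; 1ℤ; -1ℤ; _≤_; +≤+; -≤+)
import Data.Integer.Properties as ℤ
open import Data.Integer.Tactic.RingSolver using (solve-∀)
open import Data.List using (List; []; _∷_; map; null)
open import Data.List.Properties using (map-cong-local)
open import Data.List.Membership.Propositional using (_∈_; _∉_; find; lose)
open import Data.List.Membership.Propositional.Properties
  using (∈-++⁺ˡ; ∈-++⁺ʳ; ∈-++⁻; ∈-map⁺; ∈-map⁻; ∈-upTo⁺; ∈-upTo⁻)
import Data.List.Relation.Unary.All as All
open import Data.List.Relation.Unary.All.Properties using (all⁺; all⁻)
open import Data.List.Relation.Unary.Any using (here)
open import Data.List.Relation.Unary.Any.Properties using (any⁺; any⁻; ¬Any[])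
open import Data.Nat as ℕ using (ℕ; zero; suc; _<_; s≤s; z≤n)
import Data.Nat.Properties as ℕ
open import Data.Nat.ListAction using (sum)
open import Data.Product using (∃; _×_; _,_)
open import Data.Sum using (_⊎_; inj₁; inj₂)
open import Function using (id; _∘_; flip; _⇔_; mk⇔)
import Function.Properties.Equivalence as ⇔
open import Relation.Binary.PropositionalEquality

T-injective : ∀ {x y} → T x ⇔ T y → x ≡ y
T-injective x⇔y = ⇔→≡ (⇔.trans (⇔.sym T-≡) (⇔.trans x⇔y T-≡))

any-cong : ∀ {A : Set} {p q : A → Bool} xs → (∀ {x} → x ∈ xs → p x ≡ q x) → any p xs ≡ any q xs
any-cong xs p≗q = cong or (map-cong-local (All.tabulate p≗q))

all-cong : ∀ {A : Set} {p q : A → Bool} xs → (∀ {x} → x ∈ xs → p x ≡ q x) → all p xs ≡ all q xs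
all-cong xs p≗q = cong and (map-cong-local (All.tabulate p≗q))

weight : ℕ → ℤ
weight 0 = 0ℤ
weight 1 = -1ℤ
weight 2 = 1ℤ
weight (suc (suc (suc n))) = weight n

potential : Pos → ℤ
potential []      = 0ℤ
potential (x ∷ G) = weight x + potential G

potential-⊕ : ∀ G H → potential (G ⊕ H) ≡ potential G + potential H
potential-⊕ []      H = sym (ℤ.+-identityˡ (potential H))
potential-⊕ (x ∷ G) H = begin
  weight x + potential (G ⊕ H)              ≡⟨ cong (λ w → weight x + w) (potential-⊕ G H) ⟩
  weight x + (potential G + potential H)    ≡⟨ ℤ.+-assoc (weight x) _ _ ⟨
  weight x + potential G + potential H      ∎
  where open ≡-Reasoning

infix 4 _↑_ _↝_

data _↑_ (z : ℤ) : ℤ → Set where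
  up : z ↑ z + 1ℤ

data _↝_ (z z′ : ℤ) : Set where
  one-up   : z ↑ z′ → z ↝ z′
  two-down : z ≡ z′ + + 2 → z ↝ z′

↑-translate : ∀ c {z z′} → z ↑ z′ → c + z ↑ c + z′
↑-translate c {z} up = subst (c + z ↑_) (ℤ.+-assoc c z 1ℤ) up

↝-translate : ∀ c {z z′} → z ↝ z′ → c + z ↝ c + z′
↝-translate c (one-up z↑z′)           = one-up (↑-translate c z↑z′)
↝-translate c {z′ = z′} (two-down refl) = two-down (sym (ℤ.+-assoc c z′ (+ 2)))

weight-splitL : ∀ a b → weight (suc (a ℕ.+ b)) ↝ weight a + weight b
weight-splitL (suc (suc (suc a))) b = weight-splitL a b
weight-splitL 0 (suc (suc (suc b))) = weight-splitL 0 b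
weight-splitL 1 (suc (suc (suc b))) = weight-splitL 1 b
weight-splitL 2 (suc (suc (suc b))) = weight-splitL 2 b
weight-splitL 0 0 = one-up up
weight-splitL 0 1 = two-down {z′ = -1ℤ} refl
weight-splitL 0 2 = one-up up
weight-splitL 1 0 = two-down {z′ = -1ℤ} refl
weight-splitL 1 1 = two-down {z′ = -[1+ 1 ]} refl
weight-splitL 1 2 = one-up up
weight-splitL 2 0 = one-up up
weight-splitL 2 1 = one-up up
weight-splitL 2 2 = one-up up

weight-splitR : ∀ a b → weight a + weight b ↝ weight (suc (suc (a ℕ.+ b)))
weight-splitR (suc (suc (suc a))) b = weight-splitR a b
weight-splitR 0 (suc (suc (suc b))) = weight-splitR 0 b
weight-splitR 1 (suc (suc (suc b))) = weight-splitR 1 b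
weight-splitR 2 (suc (suc (suc b))) = weight-splitR 2 b
weight-splitR 0 0 = one-up up
weight-splitR 0 1 = one-up up
weight-splitR 0 2 = two-down {z′ = -1ℤ} refl
weight-splitR 1 0 = one-up up
weight-splitR 1 1 = one-up up
weight-splitR 1 2 = one-up up
weight-splitR 2 0 = two-down {z′ = -1ℤ} refl
weight-splitR 2 1 = one-up up
weight-splitR 2 2 = two-down {z′ = 0ℤ} refl

∈-splitsL⁻ : ∀ x {a b} → (a , b) ∈ splitsL x → suc (a ℕ.+ b) ≡ x
∈-splitsL⁻ (suc x) ab∈ with j , j∈ , refl ← ∈-map⁻ _ ab∈ =
  cong suc (ℕ.m+[n∸m]≡n (ℕ.≤-pred (∈-upTo⁻ j∈)))

∈-splitsR⁻ : ∀ x {a b} → (a , b) ∈ splitsR x → suc (suc (a ℕ.+ b)) ≡ x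
∈-splitsR⁻ (suc (suc x)) ab∈ with j , j∈ , refl ← ∈-map⁻ _ ab∈ =
  cong (suc ∘ suc) (ℕ.m+[n∸m]≡n (ℕ.≤-pred (∈-upTo⁻ j∈)))

∈-splitsL⁺ : ∀ a b → (a , b) ∈ splitsL (suc (a ℕ.+ b))
∈-splitsL⁺ a b = subst (λ b′ → (a , b′) ∈ splitsL (suc (a ℕ.+ b))) (ℕ.m+n∸m≡n a b)
  (∈-map⁺ _ (∈-upTo⁺ (s≤s (ℕ.m≤m+n a b))))

∈-splitsR⁺ : ∀ a b → (a , b) ∈ splitsR (suc (suc (a ℕ.+ b)))
∈-splitsR⁺ a b = subst (λ b′ → (a , b′) ∈ splitsR (suc (suc (a ℕ.+ b)))) (ℕ.m+n∸m≡n a b)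
  (∈-map⁺ _ (∈-upTo⁺ (s≤s (ℕ.m≤m+n a b))))

module _ (sp : ℕ → List (ℕ × ℕ)) where

  ∈-options-head : ∀ x {a b} rest → (a , b) ∈ sp x → a ∷ b ∷ rest ∈ options sp (x ∷ rest)
  ∈-options-head x rest ab∈ = ∈-++⁺ˡ (∈-map⁺ _ ab∈)

  ∈-options-tail : ∀ x rest {G′} → G′ ∈ options sp rest → x ∷ G′ ∈ options sp (x ∷ rest)
  ∈-options-tail x rest G′∈ = ∈-++⁺ʳ _ (∈-map⁺ _ G′∈)

  options-preserves : {R : Pos → Pos → Set} →
    (∀ {x a b} rest → (a , b) ∈ sp x → R (x ∷ rest) (a ∷ b ∷ rest)) →
    (∀ x {rest rest′} → R rest rest′ → R (x ∷ rest) (x ∷ rest′)) →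
    ∀ G {G′} → G′ ∈ options sp G → R G G′
  options-preserves head tail (x ∷ rest) G′∈ with ∈-++⁻ (map _ (sp x)) G′∈
  ... | inj₁ G′∈heads with _ , ab∈ , refl ← ∈-map⁻ _ G′∈heads = head rest ab∈
  ... | inj₂ G′∈tails with _ , R′∈ , refl ← ∈-map⁻ _ G′∈tails =
    tail x (options-preserves head tail rest R′∈)

  options-sum : (∀ {x a b} → (a , b) ∈ sp x → a ℕ.+ b < x) →
                ∀ G {G′} → G′ ∈ options sp G → sum G′ < sum G
  options-sum shrinks = options-preserves
    (λ {x} {a} {b} rest ab∈ → subst (_< x ℕ.+ sum rest) (ℕ.+-assoc a b (sum rest))
                                     (ℕ.+-monoˡ-< (sum rest) (shrinks ab∈)))
    (λ x → ℕ.+-monoʳ-< x)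

module _ {R : ℤ → ℤ → Set} (translate : ∀ c {z z′} → R z z′ → R (c + z) (c + z′)) where

  potential-split : ∀ x a b rest → R (weight x) (weight a + weight b) →
                   R (potential (x ∷ rest)) (potential (a ∷ b ∷ rest))
  potential-split x a b rest r =
    subst₂ R (ℤ.+-comm (potential rest) (weight x))
             (trans (ℤ.+-comm (potential rest) _) (ℤ.+-assoc (weight a) (weight b) _))
             (translate (potential rest) r)

  options-potential : ∀ sp →
    (∀ {x a b} → (a , b) ∈ sp x → R (weight x) (weight a + weight b)) →
    ∀ G {G′} → G′ ∈ options sp G → R (potential G) (potential G′)
  options-potential sp split = options-preserves sp
    (λ {x} {a} {b} rest ab∈ → potential-split x a b rest (split ab∈))
    (λ x → translate (weight x))

leftOption-↝ : ∀ G {G′} → G′ ∈ leftOptions G → potential G ↝ potential G′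
leftOption-↝ = options-potential ↝-translate splitsL λ {x} {a} {b} ab∈ →
  subst (λ x → weight x ↝ weight a + weight b) (∈-splitsL⁻ x ab∈) (weight-splitL a b)

rightOption-↝ : ∀ G {G′} → G′ ∈ rightOptions G → potential G′ ↝ potential G
rightOption-↝ = options-potential {flip _↝_} (λ c → ↝-translate c) splitsR
  λ {x} {a} {b} ab∈ →
  subst (λ x → weight a + weight b ↝ weight x) (∈-splitsR⁻ x ab∈) (weight-splitR a b)

leftOption-sum : ∀ G {G′} → G′ ∈ leftOptions G → sum G′ < sum G
leftOption-sum = options-sum splitsL λ {x} ab∈ → subst (_ <_) (∈-splitsL⁻ x ab∈) (ℕ.n<1+n _)

rightOption-sum : ∀ G {G′} → G′ ∈ rightOptions G → sum G′ < sum G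
rightOption-sum = options-sum splitsR λ {x} ab∈ →
  subst (_ <_) (∈-splitsR⁻ x ab∈) (ℕ.m<n⇒m<1+n (ℕ.n<1+n _))

data LeftRaisingSplit : ℕ → Set where
  length0 : LeftRaisingSplit 0
  length2 : LeftRaisingSplit 2
  split   : ∀ a b → weight (suc (a ℕ.+ b)) ↑ (weight a + weight b) →
            LeftRaisingSplit (suc (a ℕ.+ b))

leftRaisingSplit : ∀ x → LeftRaisingSplit x
leftRaisingSplit 0 = length0
leftRaisingSplit 1 = split 0 0 up
leftRaisingSplit 2 = length2
leftRaisingSplit (suc (suc (suc x))) with leftRaisingSplit x
... | length0       = split 0 2 up
... | length2       = split 2 2 up
... | split a b r   = split (3 ℕ.+ a) b r

data RightLoweringSplit : ℕ → Set where
  length0 : RightLoweringSplit 0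
  length1 : RightLoweringSplit 1
  split   : ∀ a b → (weight a + weight b) ↑ weight (suc (suc (a ℕ.+ b))) →
            RightLoweringSplit (suc (suc (a ℕ.+ b)))

rightLoweringSplit : ∀ x → RightLoweringSplit x
rightLoweringSplit 0 = length0
rightLoweringSplit 1 = length1
rightLoweringSplit 2 = split 0 0 up
rightLoweringSplit (suc (suc (suc x))) with rightLoweringSplit x
... | length0      = split 0 1 up
... | length1      = split 1 1 up
... | split a b r  = split (3 ℕ.+ a) b r

-- If Left cannot raise the potential, every strip has length 0 or 2, so the
-- potential is the number of strips of length 2.
leftRaisingOption : ∀ G → (∃ λ G′ → G′ ∈ leftOptions G × potential G ↑ potential G′)
                        ⊎ (∃ λ n → potential G ≡ + n × (n ≡ 0 → leftOptions G ≡ []))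
leftRaisingOption [] = inj₂ (0 , refl , λ _ → refl)
leftRaisingOption (x ∷ rest) with leftRaisingSplit x
... | split a b r =
  inj₁ (a ∷ b ∷ rest , ∈-options-head splitsL (suc (a ℕ.+ b)) rest (∈-splitsL⁺ a b) ,
        potential-split ↑-translate (suc (a ℕ.+ b)) a b rest r)
... | length0 with leftRaisingOption rest
...   | inj₁ (G′ , G′∈ , r) =
  inj₁ (0 ∷ G′ , ∈-options-tail splitsL 0 rest G′∈ , ↑-translate 0ℤ r)
...   | inj₂ (n , p≡n , none) =
  inj₂ (n , trans (ℤ.+-identityˡ _) p≡n , cong (map (0 ∷_)) ∘ none)
leftRaisingOption (x ∷ rest) | length2 with leftRaisingOption rest
...   | inj₁ (G′ , G′∈ , r) =
  inj₁ (2 ∷ G′ , ∈-options-tail splitsL 2 rest G′∈ , ↑-translate 1ℤ r)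
...   | inj₂ (n , p≡n , _)   = inj₂ (suc n , cong (λ w → 1ℤ + w) p≡n , λ ())

rightLoweringOption : ∀ G {G₀} → G₀ ∈ rightOptions G →
                      ∃ λ G′ → G′ ∈ rightOptions G × potential G′ ↑ potential G
rightLoweringOption (x ∷ rest) G₀∈ with rightLoweringSplit x
... | split a b r =
  a ∷ b ∷ rest , ∈-options-head splitsR (suc (suc (a ℕ.+ b))) rest (∈-splitsR⁺ a b) ,
  potential-split {flip _↑_} (λ c → ↑-translate c) (suc (suc (a ℕ.+ b))) a b rest r
... | length0 with _ , R₀∈ , _ ← ∈-map⁻ _ G₀∈ =
  let G′ , G′∈ , r = rightLoweringOption rest R₀∈
  in  0 ∷ G′ , ∈-options-tail splitsR 0 rest G′∈ , ↑-translate 0ℤ r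
... | length1 with _ , R₀∈ , _ ← ∈-map⁻ _ G₀∈ =
  let G′ , G′∈ , r = rightLoweringOption rest R₀∈
  in  1 ∷ G′ , ∈-options-tail splitsR 1 rest G′∈ , ↑-translate -1ℤ r

noLeftOption⇒potential≡0 : ∀ G → (∀ {G′} → G′ ∉ leftOptions G) → potential G ≡ 0ℤ
noLeftOption⇒potential≡0 []            _    = refl
noLeftOption⇒potential≡0 (zero ∷ rest) none =
  trans (ℤ.+-identityˡ _)
        (noLeftOption⇒potential≡0 rest (none ∘ ∈-options-tail splitsL 0 rest))
noLeftOption⇒potential≡0 (suc x ∷ rest) none = ⊥-elim (none (here refl))

noRightOption⇒potential≤0 : ∀ G → (∀ {G′} → G′ ∉ rightOptions G) → potential G ≤ 0ℤ
noRightOption⇒potential≤0 []                    _    = ℤ.≤-refl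
noRightOption⇒potential≤0 (0 ∷ rest)            none =
  ℤ.+-mono-≤ (ℤ.≤-refl {0ℤ})
             (noRightOption⇒potential≤0 rest (none ∘ ∈-options-tail splitsR 0 rest))
noRightOption⇒potential≤0 (1 ∷ rest)            none =
  ℤ.+-mono-≤ -≤+ (noRightOption⇒potential≤0 rest (none ∘ ∈-options-tail splitsR 1 rest))
noRightOption⇒potential≤0 (suc (suc x) ∷ rest) none = ⊥-elim (none (here refl))

leftWinsFirstAt : ℤ → Bool
leftWinsFirstAt (+ 0)                   = true
leftWinsFirstAt (+ 1)                   = false
leftWinsFirstAt (+ 2)                   = false
leftWinsFirstAt (+ suc (suc (suc n)))   = leftWinsFirstAt (+ n)
leftWinsFirstAt -[1+ _ ]                = false

leftWinsSecondAt : ℤ → Bool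
leftWinsSecondAt (+ zero)  = false
leftWinsSecondAt (+ suc n) = leftWinsFirstAt (+ n)
leftWinsSecondAt -[1+ _ ]  = false

leftWinsSecondAt-↑ : ∀ {z z′} → z ↑ z′ → leftWinsSecondAt z′ ≡ leftWinsFirstAt z
leftWinsSecondAt-↑ {+ n}          up rewrite ℕ.+-comm n 1 = refl
leftWinsSecondAt-↑ { -[1+ 0 ]}    up = refl
leftWinsSecondAt-↑ { -[1+ suc _ ]} up = refl

↝-leftWinsSecond⇒First : ∀ {u v} → u ↝ v → T (leftWinsSecondAt v) → T (leftWinsFirstAt u)
↝-leftWinsSecond⇒First (one-up r) = subst T (leftWinsSecondAt-↑ r)
↝-leftWinsSecond⇒First {v = + suc n} (two-down refl) rewrite ℕ.+-comm n 2 = id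
↝-leftWinsSecond⇒First {v = + zero}   (two-down refl) ()
↝-leftWinsSecond⇒First {v = -[1+ _ ]} (two-down refl) ()

↝-leftWinsFirst⇒Second : ∀ {u v} → u ↝ v → T (leftWinsFirstAt u) → u ≢ 0ℤ →
                         T (leftWinsSecondAt v)
↝-leftWinsFirst⇒Second (one-up r) w _ = subst T (sym (leftWinsSecondAt-↑ r)) w
↝-leftWinsFirst⇒Second {v = + suc n} (two-down refl) w _ rewrite ℕ.+-comm n 2 = w
↝-leftWinsFirst⇒Second {v = + zero}               (two-down refl) ()
↝-leftWinsFirst⇒Second {v = -[1+ 0 ]}             (two-down refl) ()
↝-leftWinsFirst⇒Second {v = -[1+ 1 ]}             (two-down refl) _ u≢0 = ⊥-elim (u≢0 refl)
↝-leftWinsFirst⇒Second {v = -[1+ suc (suc _) ]}   (two-down refl) ()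

leftWinsSecondAt-≤0 : ∀ {z} → z ≤ 0ℤ → leftWinsSecondAt z ≡ false
leftWinsSecondAt-≤0 -≤+         = refl
leftWinsSecondAt-≤0 (+≤+ z≤n)   = refl

leftWinsFirstAt-recurrence : ∀ G →
  null (leftOptions G) ∨ any (leftWinsSecondAt ∘ potential) (leftOptions G)
    ≡ leftWinsFirstAt (potential G)
leftWinsFirstAt-recurrence G with leftOptions G in eq
... | [] = cong leftWinsFirstAt
  (sym (noLeftOption⇒potential≡0 G λ G′∈ → ¬Any[] (subst (_ ∈_) eq G′∈)))
... | o ∷ os = T-injective (mk⇔ to from)
  where
  to : T (any (leftWinsSecondAt ∘ potential) (o ∷ os)) → T (leftWinsFirstAt (potential G))
  to h = let G′ , G′∈ , w = find (any⁻ _ (o ∷ os) h)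
         in ↝-leftWinsSecond⇒First (leftOption-↝ G (subst (G′ ∈_) (sym eq) G′∈)) w
  from : T (leftWinsFirstAt (potential G)) → T (any (leftWinsSecondAt ∘ potential) (o ∷ os))
  from w with leftRaisingOption G
  ... | inj₁ (G′ , G′∈ , r) =
    any⁺ (leftWinsSecondAt ∘ potential)
         (lose (subst (G′ ∈_) eq G′∈) (subst T (sym (leftWinsSecondAt-↑ r)) w))
  ... | inj₂ (n , p≡n , none) =
    any⁺ (leftWinsSecondAt ∘ potential) (here {x = o} {xs = os}
      (↝-leftWinsFirst⇒Second (leftOption-↝ G (subst (o ∈_) (sym eq) (here refl))) w p≢0))
    where
    p≢0 : potential G ≢ 0ℤ
    p≢0 p≡0 with () ← trans (sym (none (ℤ.+-injective (trans (sym p≡n) p≡0)))) eq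

leftWinsSecondAt-recurrence : ∀ G →
  not (null (rightOptions G)) ∧ all (leftWinsFirstAt ∘ potential) (rightOptions G)
    ≡ leftWinsSecondAt (potential G)
leftWinsSecondAt-recurrence G with rightOptions G in eq
... | [] = sym (leftWinsSecondAt-≤0
  (noRightOption⇒potential≤0 G λ G′∈ → ¬Any[] (subst (_ ∈_) eq G′∈)))
... | o ∷ os = T-injective (mk⇔ to from)
  where
  to : T (all (leftWinsFirstAt ∘ potential) (o ∷ os)) → T (leftWinsSecondAt (potential G))
  to h = let G′ , G′∈ , r = rightLoweringOption G (subst (o ∈_) (sym eq) (here refl))
         in subst T (sym (leftWinsSecondAt-↑ r))
                  (All.lookup (all⁺ _ (o ∷ os) h) (subst (G′ ∈_) eq G′∈))
  from : T (leftWinsSecondAt (potential G)) → T (all (leftWinsFirstAt ∘ potential) (o ∷ os))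
  from w = all⁻ _ (All.tabulate λ {G′} G′∈ →
    ↝-leftWinsSecond⇒First (rightOption-↝ G (subst (G′ ∈_) (sym eq) G′∈)) w)

mutual
  leftWinsFirst-potential : ∀ k G → sum G < k →
                            leftWinsFirst k G ≡ leftWinsFirstAt (potential G)
  leftWinsFirst-potential (suc k) G (s≤s sG≤k) = begin
    null (leftOptions G) ∨ any (leftWinsSecond k) (leftOptions G)
      ≡⟨ cong (null (leftOptions G) ∨_) (any-cong (leftOptions G) λ {G′} G′∈ →
           leftWinsSecond-potential k G′ (ℕ.<-≤-trans (leftOption-sum G G′∈) sG≤k)) ⟩
    null (leftOptions G) ∨ any (leftWinsSecondAt ∘ potential) (leftOptions G)
      ≡⟨ leftWinsFirstAt-recurrence G ⟩
    leftWinsFirstAt (potential G) ∎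
    where open ≡-Reasoning

  leftWinsSecond-potential : ∀ k G → sum G < k →
                             leftWinsSecond k G ≡ leftWinsSecondAt (potential G)
  leftWinsSecond-potential (suc k) G (s≤s sG≤k) = begin
    not (null (rightOptions G)) ∧ all (leftWinsFirst k) (rightOptions G)
      ≡⟨ cong (not (null (rightOptions G)) ∧_) (all-cong (rightOptions G) λ {G′} G′∈ →
           leftWinsFirst-potential k G′ (ℕ.<-≤-trans (rightOption-sum G G′∈) sG≤k)) ⟩
    not (null (rightOptions G)) ∧ all (leftWinsFirstAt ∘ potential) (rightOptions G)
      ≡⟨ leftWinsSecondAt-recurrence G ⟩
    leftWinsSecondAt (potential G) ∎
    where open ≡-Reasoning

outcomeAt : ℤ → Outcome
outcomeAt z = outcomeOf (leftWinsFirstAt z) (leftWinsSecondAt z)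

o⁻≡outcomeAt : ∀ G → o⁻ G ≡ outcomeAt (potential G)
o⁻≡outcomeAt G = cong₂ outcomeOf
  (leftWinsFirst-potential _ G (ℕ.n<1+n (sum G)))
  (leftWinsSecond-potential _ G (ℕ.n<1+n (sum G)))

≥ₒ-reflexive : ∀ {o o′} → o ≡ o′ → o ≥ₒ o′
≥ₒ-reflexive refl = refl≥

outcomeAt-+3 : ∀ z → outcomeAt (z + + 3) ≥ₒ outcomeAt z
outcomeAt-+3 (+ zero)                          = refl≥
outcomeAt-+3 (+ suc n) rewrite ℕ.+-comm n 3    = refl≥
outcomeAt-+3 -[1+ _ ]                          = ≥R

↝-outcomeAt : ∀ {u v} → u ↝ v → ∀ c → outcomeAt (u + c) ≥ₒ outcomeAt ((v + -1ℤ) + c)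
↝-outcomeAt {u} (one-up up) c = ≥ₒ-reflexive (cong outcomeAt (cancel u c))
  where
  cancel : ∀ u c → u + c ≡ (u + + 1 + -[1+ 0 ]) + c
  cancel = solve-∀
↝-outcomeAt {v = v} (two-down refl) c =
  subst (λ z → outcomeAt z ≥ₒ outcomeAt ((v + -1ℤ) + c)) (sym (shift v c))
        (outcomeAt-+3 ((v + -1ℤ) + c))
  where
  shift : ∀ v c → (v + + 2) + c ≡ ((v + -[1+ 0 ]) + c) + + 3
  shift = solve-∀

lemma2p2 : (G GL : Pos) → GL ∈ leftOptions G → G ≧K (GL ⊕ S 1)
lemma2p2 G GL GL∈G X
  rewrite o⁻≡outcomeAt (G ⊕ X) | o⁻≡outcomeAt (GL ⊕ S 1 ⊕ X)
        | potential-⊕ G X | potential-⊕ (GL ⊕ S 1) X | potential-⊕ GL (S 1)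
  = ↝-outcomeAt (leftOption-↝ G GL∈G) (potential X)
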